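{- Let $n\ge3$ and let $C_n$ be the directed cycle graph on vertices $v_1,\dots,v_n$ (in cyclic order) whose arrows are $v_n\to v_1$, $v_2\to v_1$, $v_3\to v_2$ (one-directional), and bi-directional arrows $v_i\leftrightarrow v_{i+1}$ for $3\le i\le n-1$. Then $\operatorname{Pic}(C_n)\cong\mathbb{Z}\times\mathbb{Z}_{n-1}$ and $\operatorname{Jac}(C_n)\cong\mathbb{Z}_{n-1}$.
   Context: A bi-directional arrow between $u,w$ counts as an arrow from $u$ to $w$ and one from $w$ to $u$. The Laplacian $L_G$ of a directed graph $G$ on $v_1,\dots,v_n$ is the $n\times n$ integer matrix with $(i,i)$ entry the number of outgoing arrows of $v_i$ and $(i,j)$ entry ($i\ne j$) minus the number of arrows from $v_i$ to $v_j$. $\operatorname{Pic}(G)=\mathbb{Z}^n/L_G^T\mathbb{Z}^n$, $\operatorname{Jac}(G)$ is its torsion subgroup, $\mathbb{Z}_k=\mathbb{Z}/k\mathbb{Z}$. -}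

module Defs where

open import Data.Nat as ℕ using (ℕ; zero; suc; _∸_)
import Data.Nat.Properties as ℕP
open import Data.Integer as ℤ using (ℤ; +_; _+_; _-_; _*_; -_)
open import Data.Integer.Divisibility using (_∣_)
open import Data.Fin using (Fin; toℕ)
import Data.Fin.Properties as FinP
open import Data.Product using (Σ; _×_; _,_; proj₁; proj₂)
open import Relation.Nullary using (Dec; yes; no)
open import Relation.Binary.PropositionalEquality using (_≡_)

-- Generic notions for a directed (multi)graph on vertices Fin n,
-- given by its arrow-count function  arr i j = #arrows from v_i to v_j.

Vecℤ : ℕ → Set
Vecℤ n = Fin n → ℤ

Σℤ : ∀ {n} → (Fin n → ℤ) → ℤ
Σℤ {zero}  f = + 0
Σℤ {suc n} f = f Data.Fin.zero + Σℤ (λ i → f (Data.Fin.suc i))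

Σℕ : ∀ {n} → (Fin n → ℕ) → ℕ
Σℕ {zero}  f = 0
Σℕ {suc n} f = f Data.Fin.zero ℕ.+ Σℕ (λ i → f (Data.Fin.suc i))

Laplacian : ∀ {n} → (Fin n → Fin n → ℕ) → Fin n → Fin n → ℤ
Laplacian arr i j with i FinP.≟ j
... | yes _ = + Σℕ (arr i)
... | no  _ = - (+ arr i j)

InImageLT : ∀ {n} → (Fin n → Fin n → ℤ) → Vecℤ n → Set
InImageLT {n} L x = Σ (Vecℤ n) λ c → ∀ j → x j ≡ Σℤ (λ i → c i * L i j)

-- equality in Pic(G) = ℤ^n / L^T ℤ^n
PicEq : ∀ {n} → (Fin n → Fin n → ℤ) → Vecℤ n → Vecℤ n → Set
PicEq L x y = InImageLT L (λ j → x j - y j)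

-- x represents a torsion element of Pic(G), i.e. an element of Jac(G)
IsTorsion : ∀ {n} → (Fin n → Fin n → ℤ) → Vecℤ n → Set
IsTorsion L x = Σ ℕ λ k → InImageLT L (λ j → + suc k * x j)

ModEq : ℕ → ℤ → ℤ → Set
ModEq m a b = (+ m) ∣ (a - b)

-- Pic(G) ≅ ℤ × ℤ_m : a homomorphism φ : ℤ^n → ℤ × ℤ_m (represented on ℤ × ℤ)
-- that descends to a bijective map Pic(G) → ℤ × ℤ_m.
EqZ×Zm : ℕ → ℤ × ℤ → ℤ × ℤ → Set
EqZ×Zm m (a , b) (a' , b') = (a ≡ a') × ModEq m b b'

PicIsoZ×Zm : ∀ {n} → (Fin n → Fin n → ℤ) → ℕ → Set
PicIsoZ×Zm {n} L m =
  Σ (Vecℤ n → ℤ × ℤ) λ φ →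
    (∀ x y → EqZ×Zm m (φ (λ j → x j + y j))
                      (proj₁ (φ x) + proj₁ (φ y) , proj₂ (φ x) + proj₂ (φ y)))
  × (∀ x y → (PicEq L x y → EqZ×Zm m (φ x) (φ y)) × (EqZ×Zm m (φ x) (φ y) → PicEq L x y))
  × (∀ t → Σ (Vecℤ n) λ x → EqZ×Zm m (φ x) t)

-- Jac(G) ≅ ℤ_m : a homomorphism ψ from the torsion elements to ℤ_m
-- (represented on ℤ) that descends to a bijection Jac(G) → ℤ_m.
JacIsoZm : ∀ {n} → (Fin n → Fin n → ℤ) → ℕ → Set
JacIsoZm {n} L m =
  Σ ((x : Vecℤ n) → IsTorsion L x → ℤ) λ ψ →
    (∀ x y (tx : IsTorsion L x) (ty : IsTorsion L y)
           (txy : IsTorsion L (λ j → x j + y j)) →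
       ModEq m (ψ (λ j → x j + y j) txy) (ψ x tx + ψ y ty))
  × (∀ x y (tx : IsTorsion L x) (ty : IsTorsion L y) →
       (PicEq L x y → ModEq m (ψ x tx) (ψ y ty)) × (ModEq m (ψ x tx) (ψ y ty) → PicEq L x y))
  × (∀ b → Σ (Vecℤ n) λ x → Σ (IsTorsion L x) λ tx → ModEq m (ψ x tx) b)

-- The graph C_n.  Vertex v_{k+1} is index k : Fin n (0-based).
-- Arrows: v_n → v_1, v_2 → v_1, v_3 → v_2, and v_i ↔ v_{i+1} for 3 ≤ i ≤ n-1
-- (0-based: k ↔ k+1 for 2 ≤ k ≤ n-2).

[_] : ∀ {P : Set} → Dec P → ℕ
[ yes _ ] = 1
[ no  _ ] = 0

arrowsℕ : ℕ → ℕ → ℕ → ℕ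
arrowsℕ n a b =
      [ a ℕP.≟ (n ∸ 1) ] ℕ.* [ b ℕP.≟ 0 ]                       -- v_n → v_1
  ℕ.+ [ a ℕP.≟ 1 ] ℕ.* [ b ℕP.≟ 0 ]                             -- v_2 → v_1
  ℕ.+ [ a ℕP.≟ 2 ] ℕ.* [ b ℕP.≟ 1 ]                             -- v_3 → v_2
  ℕ.+ [ 2 ℕP.≤? a ] ℕ.* [ a ℕP.≤? n ∸ 2 ] ℕ.* [ b ℕP.≟ suc a ]  -- v_i → v_{i+1}, 3 ≤ i ≤ n-1
  ℕ.+ [ 2 ℕP.≤? b ] ℕ.* [ b ℕP.≤? n ∸ 2 ] ℕ.* [ a ℕP.≟ suc b ]  -- v_{i+1} → v_i, 3 ≤ i ≤ n-1

Cₙ-arrows : (n : ℕ) → Fin n → Fin n → ℕ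
Cₙ-arrows n i j = arrowsℕ n (toℕ i) (toℕ j)

L-Cₙ : (n : ℕ) → Fin n → Fin n → ℤ
L-Cₙ n = Laplacian (Cₙ-arrows n)

module Submission where

open import Defs
open import Data.Nat using (ℕ; _≤_; _∸_)
open import Data.Product using (_×_)
open import Data.Nat as ℕ using (zero; suc; _<_; _%_; s≤s; z≤n; NonZero)
import Data.Nat.Properties as ℕP
import Data.Nat.DivMod as ℕD
import Data.Nat.Tactic.RingSolver as ℕ-Solver
open import Data.Integer as ℤ using (ℤ; +_; _+_; _-_; _*_; -_; 0ℤ; 1ℤ)
import Data.Integer.Properties as ℤP
open import Data.Integer.Tactic.RingSolver using (solve-∀)
import Data.Integer.Divisibility.Signed as Signed
open Signed using (divides)
open import Data.Fin using (Fin; toℕ; fromℕ<) renaming (zero to fzero; suc to fsuc)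
import Data.Fin.Properties as FinP
open import Data.List using (List; []; _∷_; length)
open import Data.List.Relation.Unary.All using (All; []; _∷_)
open import Data.Product using (_,_; proj₁)
open import Data.Empty using (⊥-elim)
open import Function using (_∘_; const)
open import Relation.Nullary using (Dec; yes; no; ¬_)
open import Relation.Binary.PropositionalEquality hiding ([_])
open import Relation.Binary.Bundles using (Setoid)
import Relation.Binary.Reasoning.Setoid as SetoidReasoning

-- Write eₐ for the basis vector of the vertex with index a (that is, of v_{a+1}) and n' = n − 1.
-- The rows of the Laplacian of Cₙ are 0 (v₁ has no outgoing arrow), e₁ − e₀,
-- 2eₐ − eₐ₋₁ − eₐ₊₁ for 2 ≤ a < n', and 2eₙ' − eₙ'₋₁ − e₀. Every row has coordinate sum 0, and
-- for the weights w₀ = 0, wₐ = a − 1 every row has weighted sum 0 except the last, whose weighted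
-- sum is n'. So x ↦ (Σ xₐ, Σ wₐ xₐ mod n') is well defined on Pic(Cₙ). Conversely, with
-- tₐ = eₐ₊₁ − eₐ the middle rows say tₐ₋₁ ≡ tₐ, so every tₐ with a ≥ 1 is congruent to g = e₂ − e₁;
-- together with e₁ ≡ e₀ this gives eₐ ≡ e₀ + wₐ g, and the last row then reads n' g ≡ 0. Hence
-- x ≡ (Σ xₐ) e₀ + (Σ wₐ xₐ) g with the second coefficient mattering only modulo n', and the torsion
-- classes are exactly those of degree 0.

[]-yes : ∀ {P : Set} (d : Dec P) → P → [ d ] ≡ 1
[]-yes (yes _) _ = refl
[]-yes (no ¬p) p = ⊥-elim (¬p p)

[]-no : ∀ {P : Set} (d : Dec P) → ¬ P → [ d ] ≡ 0
[]-no (yes p) ¬p = ⊥-elim (¬p p)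
[]-no (no _)  _  = refl

Σℤ-cong : ∀ {n} {f g : Fin n → ℤ} → (∀ j → f j ≡ g j) → Σℤ f ≡ Σℤ g
Σℤ-cong {zero}  _  = refl
Σℤ-cong {suc _} eq = cong₂ _+_ (eq fzero) (Σℤ-cong (eq ∘ fsuc))

Σℤ-+ : ∀ {n} (f g : Fin n → ℤ) → Σℤ (λ j → f j + g j) ≡ Σℤ f + Σℤ g
Σℤ-+ {zero}  f g = refl
Σℤ-+ {suc _} f g = trans (cong (_+_ (f fzero + g fzero)) (Σℤ-+ (f ∘ fsuc) (g ∘ fsuc)))
                         (interchange (f fzero) (g fzero) _ _)
  where
  interchange : ∀ a b c d → (a + b) + (c + d) ≡ (a + c) + (b + d)
  interchange = solve-∀

Σℤ-*ˡ : ∀ {n} k (f : Fin n → ℤ) → Σℤ (λ j → k * f j) ≡ k * Σℤ f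
Σℤ-*ˡ {zero}  k f = sym (ℤP.*-zeroʳ k)
Σℤ-*ˡ {suc _} k f = trans (cong (_+_ (k * f fzero)) (Σℤ-*ˡ k (f ∘ fsuc)))
                          (sym (ℤP.*-distribˡ-+ k (f fzero) _))

Σℤ-0 : ∀ {n} → Σℤ {n} (λ _ → 0ℤ) ≡ 0ℤ
Σℤ-0 {zero}  = refl
Σℤ-0 {suc n} = trans (ℤP.+-identityˡ _) (Σℤ-0 {n})

Σℤ-comm : ∀ {m n} (f : Fin m → Fin n → ℤ) →
          Σℤ (λ j → Σℤ (λ i → f i j)) ≡ Σℤ (λ i → Σℤ (λ j → f i j))
Σℤ-comm {m} {zero}  f = sym (Σℤ-0 {m})
Σℤ-comm {m} {suc _} f = trans (cong (_+_ (Σℤ (λ i → f i fzero))) (Σℤ-comm (λ i → f i ∘ fsuc)))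
                              (sym (Σℤ-+ (λ i → f i fzero) _))

Σℤ-∣ : ∀ {n} {d} (f : Fin n → ℤ) → (∀ j → d Signed.∣ f j) → d Signed.∣ Σℤ f
Σℤ-∣ {zero}  {d} f d∣f = divides 0ℤ (sym (ℤP.*-zeroˡ d))
Σℤ-∣ {suc _}     f d∣f = Signed.∣m∣n⇒∣m+n (d∣f fzero) (Σℤ-∣ (f ∘ fsuc) (d∣f ∘ fsuc))

+Σℕ : ∀ {n} (f : Fin n → ℕ) → + Σℕ f ≡ Σℤ (λ j → + f j)
+Σℕ {zero}  f = refl
+Σℕ {suc n} f = cong (_+_ (+ f fzero)) (+Σℕ (f ∘ fsuc))

δ : ℕ → ℕ → ℤ
δ a b = + [ a ℕP.≟ b ]

δ-refl : ∀ a → δ a a ≡ 1ℤ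
δ-refl a = cong +_ ([]-yes (a ℕP.≟ a) refl)

δ-≢ : ∀ {a b} → ¬ a ≡ b → δ a b ≡ 0ℤ
δ-≢ {a} {b} a≢b = cong +_ ([]-no (a ℕP.≟ b) a≢b)

δ-suc : ∀ a b → δ (suc a) (suc b) ≡ δ a b
δ-suc a b with a ℕP.≟ b
... | yes refl = δ-refl (suc a)
... | no a≢b   = δ-≢ (a≢b ∘ ℕP.suc-injective)

δ-sym : ∀ a b → δ a b ≡ δ b a
δ-sym a b with a ℕP.≟ b
... | yes refl = sym (δ-refl a)
... | no a≢b   = sym (δ-≢ (a≢b ∘ sym))

Σℤ-δ : ∀ {n} (i : Fin n) (f : Fin n → ℤ) → Σℤ (λ j → δ (toℕ j) (toℕ i) * f j) ≡ f i
Σℤ-δ {suc n} fzero f = begin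
  1ℤ * f fzero + Σℤ (λ j → 0ℤ * f (fsuc j))
    ≡⟨ cong₂ _+_ (ℤP.*-identityˡ (f fzero)) (Σℤ-cong (ℤP.*-zeroˡ ∘ f ∘ fsuc)) ⟩
  f fzero + Σℤ {n} (λ _ → 0ℤ)
    ≡⟨ cong (_+_ (f fzero)) (Σℤ-0 {n}) ⟩
  f fzero + 0ℤ
    ≡⟨ ℤP.+-identityʳ _ ⟩
  f fzero
    ∎
  where open ≡-Reasoning
Σℤ-δ {suc n} (fsuc i) f = begin
  0ℤ * f fzero + Σℤ (λ j → δ (suc (toℕ j)) (suc (toℕ i)) * f (fsuc j))
    ≡⟨ cong₂ _+_ (ℤP.*-zeroˡ (f fzero))
                 (Σℤ-cong (λ j → cong (_* f (fsuc j)) (δ-suc (toℕ j) (toℕ i)))) ⟩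
  0ℤ + Σℤ (λ j → δ (toℕ j) (toℕ i) * f (fsuc j))
    ≡⟨ ℤP.+-identityˡ _ ⟩
  Σℤ (λ j → δ (toℕ j) (toℕ i) * f (fsuc j))
    ≡⟨ Σℤ-δ i (f ∘ fsuc) ⟩
  f (fsuc i)
    ∎
  where open ≡-Reasoning

occurrences : ℕ → List ℕ → ℕ
occurrences b []       = 0
occurrences b (x ∷ xs) = [ b ℕP.≟ x ] ℕ.+ occurrences b xs

listSum : (ℕ → ℤ) → List ℕ → ℤ
listSum h []       = 0ℤ
listSum h (x ∷ xs) = h x + listSum h xs

listSum-const-1 : ∀ xs → listSum (const 1ℤ) xs ≡ + length xs
listSum-const-1 []       = refl
listSum-const-1 (x ∷ xs) = cong (_+_ 1ℤ) (listSum-const-1 xs)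

module Vectors (n : ℕ) where

  infixl 6 _⊕_ _⊖_
  infixr 7 _⊛_
  infix  8 _·_

  _⊕_ _⊖_ : Vecℤ n → Vecℤ n → Vecℤ n
  (x ⊕ y) j = x j + y j
  (x ⊖ y) j = x j - y j

  _⊛_ : ℤ → Vecℤ n → Vecℤ n
  (k ⊛ x) j = k * x j

  𝟘 : Vecℤ n
  𝟘 _ = 0ℤ

  -- Coordinates are read through toℕ, so e a = 𝟘 for a ≥ n.
  e : ℕ → Vecℤ n
  e a j = δ (toℕ j) a

  ⌊_⌋ : (ℕ → ℤ) → Vecℤ n
  ⌊ h ⌋ j = h (toℕ j)

  _·_ : Vecℤ n → Vecℤ n → ℤ
  u · x = Σℤ (λ j → u j * x j)

  ·-comm : ∀ u x → u · x ≡ x · u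
  ·-comm u x = Σℤ-cong (λ j → ℤP.*-comm (u j) (x j))

  ·-congʳ : ∀ u {x y} → x ≗ y → u · x ≡ u · y
  ·-congʳ u eq = Σℤ-cong (λ j → cong (u j *_) (eq j))

  ·-⊕ʳ : ∀ u x y → u · (x ⊕ y) ≡ u · x + u · y
  ·-⊕ʳ u x y = trans (Σℤ-cong (λ j → ℤP.*-distribˡ-+ (u j) (x j) (y j)))
                     (Σℤ-+ (λ j → u j * x j) (λ j → u j * y j))

  ·-⊛ʳ : ∀ u k x → u · (k ⊛ x) ≡ k * (u · x)
  ·-⊛ʳ u k x = trans (Σℤ-cong (λ j → xy-commute (u j) k (x j))) (Σℤ-*ˡ k (λ j → u j * x j))
    where
    xy-commute : ∀ a b c → a * (b * c) ≡ b * (a * c)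
    xy-commute = solve-∀

  ·-⊖ʳ : ∀ u x y → u · (x ⊖ y) ≡ u · x - u · y
  ·-⊖ʳ u x y = begin
    u · (x ⊖ y)               ≡⟨ ·-congʳ u (λ j → minus-as-scale (x j) (y j)) ⟩
    u · (x ⊕ - 1ℤ ⊛ y)        ≡⟨ ·-⊕ʳ u x _ ⟩
    u · x + u · (- 1ℤ ⊛ y)    ≡⟨ cong (_+_ (u · x)) (·-⊛ʳ u (- 1ℤ) y) ⟩
    u · x + - 1ℤ * (u · y)    ≡⟨ minus-as-scale (u · x) (u · y) ⟨
    u · x - u · y             ∎
    where
    open ≡-Reasoning
    minus-as-scale : ∀ a b → a - b ≡ a + - 1ℤ * b
    minus-as-scale = solve-∀

  ·-⊕ˡ : ∀ x y u → (x ⊕ y) · u ≡ x · u + y · u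
  ·-⊕ˡ x y u = trans (·-comm (x ⊕ y) u) (trans (·-⊕ʳ u x y) (cong₂ _+_ (·-comm u x) (·-comm u y)))

  ·-⊛ˡ : ∀ k x u → (k ⊛ x) · u ≡ k * (x · u)
  ·-⊛ˡ k x u = trans (·-comm (k ⊛ x) u) (trans (·-⊛ʳ u k x) (cong (k *_) (·-comm u x)))

  ·-𝟘 : ∀ u → u · 𝟘 ≡ 0ℤ
  ·-𝟘 u = trans (Σℤ-cong (ℤP.*-zeroʳ ∘ u)) (Σℤ-0 {n})

  ·-e : ∀ h {a} → a < n → ⌊ h ⌋ · e a ≡ h a
  ·-e h {a} a<n = begin
    ⌊ h ⌋ · e a        ≡⟨ ·-comm ⌊ h ⌋ (e a) ⟩
    e a · ⌊ h ⌋        ≡⟨ cong (λ b → e b · ⌊ h ⌋) (FinP.toℕ-fromℕ< a<n) ⟨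
    e (toℕ i) · ⌊ h ⌋  ≡⟨ Σℤ-δ i ⌊ h ⌋ ⟩
    h (toℕ i)          ≡⟨ cong h (FinP.toℕ-fromℕ< a<n) ⟩
    h a                ∎
    where
    open ≡-Reasoning
    i : Fin n
    i = fromℕ< a<n

module Laplacian-Rows (n : ℕ) where

  open Vectors n

  𝟙 : List ℕ → Vecℤ n
  𝟙 xs j = + occurrences (toℕ j) xs

  ·-𝟙 : ∀ h {xs} → All (_< n) xs → ⌊ h ⌋ · 𝟙 xs ≡ listSum h xs
  ·-𝟙 h {[]}     []           = ·-𝟘 ⌊ h ⌋
  ·-𝟙 h {x ∷ xs} (x<n ∷ xs<n) =
    trans (·-⊕ʳ ⌊ h ⌋ (e x) (𝟙 xs)) (cong₂ _+_ (·-e h x<n) (·-𝟙 h xs<n))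

  laplacianRow : ℕ → List ℕ → Vecℤ n
  laplacianRow a xs = + length xs ⊛ e a ⊖ 𝟙 xs

  ·-laplacianRow : ∀ h {a xs} → a < n → All (_< n) xs →
                   ⌊ h ⌋ · laplacianRow a xs ≡ + length xs * h a - listSum h xs
  ·-laplacianRow h {a} {xs} a<n xs<n =
    trans (·-⊖ʳ ⌊ h ⌋ (+ length xs ⊛ e a) (𝟙 xs))
          (cong₂ _-_ (trans (·-⊛ʳ ⌊ h ⌋ (+ length xs) (e a)) (cong (+ length xs *_) (·-e h a<n)))
                     (·-𝟙 h xs<n))

  𝟏·laplacianRow : ∀ {a xs} → a < n → All (_< n) xs → ⌊ const 1ℤ ⌋ · laplacianRow a xs ≡ 0ℤ
  𝟏·laplacianRow {a} {xs} a<n xs<n = begin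
    ⌊ const 1ℤ ⌋ · laplacianRow a xs          ≡⟨ ·-laplacianRow (const 1ℤ) a<n xs<n ⟩
    + length xs * 1ℤ - listSum (const 1ℤ) xs  ≡⟨ cong (_-_ (+ length xs * 1ℤ)) (listSum-const-1 xs) ⟩
    + length xs * 1ℤ - + length xs            ≡⟨ cancel (+ length xs) ⟩
    0ℤ                                        ∎
    where
    open ≡-Reasoning
    cancel : ∀ d → d * 1ℤ - d ≡ 0ℤ
    cancel = solve-∀

  Laplacian-row : ∀ (arr : Fin n → Fin n → ℕ) i xs →
                  (∀ j → arr i j ≡ occurrences (toℕ j) xs) → occurrences (toℕ i) xs ≡ 0 →
                  All (_< n) xs → Laplacian arr i ≗ laplacianRow (toℕ i) xs
  Laplacian-row arr i xs arr≡occ no-loop xs<n j with i FinP.≟ j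
  ... | yes refl = begin
    + Σℕ (arr i)                    ≡⟨ +Σℕ (arr i) ⟩
    Σℤ (λ j → + arr i j)            ≡⟨ Σℤ-cong (λ j → sym (trans (ℤP.*-identityˡ _) (cong +_ (sym (arr≡occ j))))) ⟩
    ⌊ const 1ℤ ⌋ · 𝟙 xs             ≡⟨ ·-𝟙 (const 1ℤ) xs<n ⟩
    listSum (const 1ℤ) xs           ≡⟨ listSum-const-1 xs ⟩
    + length xs                     ≡⟨ diagonal (+ length xs) ⟩
    + length xs * 1ℤ - 0ℤ           ≡⟨ cong₂ (λ d o → + length xs * d - + o) (δ-refl (toℕ i)) no-loop ⟨
    laplacianRow (toℕ i) xs i       ∎
    where
    open ≡-Reasoning
    diagonal : ∀ d → d ≡ d * 1ℤ - 0ℤ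
    diagonal = solve-∀
  ... | no i≢j = begin
    - (+ arr i j)                   ≡⟨ cong (λ o → - + o) (arr≡occ j) ⟩
    - 𝟙 xs j                        ≡⟨ off-diagonal (+ length xs) (𝟙 xs j) ⟩
    + length xs * 0ℤ - 𝟙 xs j       ≡⟨ cong (λ d → + length xs * d - 𝟙 xs j) δ≡0 ⟨
    laplacianRow (toℕ i) xs j       ∎
    where
    open ≡-Reasoning
    δ≡0 : δ (toℕ j) (toℕ i) ≡ 0ℤ
    δ≡0 = δ-≢ (i≢j ∘ sym ∘ FinP.toℕ-injective)
    off-diagonal : ∀ d o → - o ≡ d * 0ℤ - o
    off-diagonal = solve-∀

module Image {n : ℕ} (L : Fin n → Fin n → ℤ) where

  open Vectors n

  Im : Vecℤ n → Set
  Im = InImageLT L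

  Im-resp : ∀ {x y} → x ≗ y → Im x → Im y
  Im-resp x≗y (c , x≡cL) = c , λ j → trans (sym (x≗y j)) (x≡cL j)

  Im-𝟘 : Im 𝟘
  Im-𝟘 = 𝟘 , λ j → sym (trans (·-comm 𝟘 (λ i → L i j)) (·-𝟘 (λ i → L i j)))

  Im-⊕ : ∀ {x y} → Im x → Im y → Im (x ⊕ y)
  Im-⊕ (c , x≡cL) (d , y≡dL) = c ⊕ d , λ j →
    trans (cong₂ _+_ (x≡cL j) (y≡dL j)) (sym (·-⊕ˡ c d (λ i → L i j)))

  Im-⊛ : ∀ k {x} → Im x → Im (k ⊛ x)
  Im-⊛ k (c , x≡cL) = k ⊛ c , λ j →
    trans (cong (k *_) (x≡cL j)) (sym (·-⊛ˡ k c (λ i → L i j)))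

  Im-row : ∀ i → Im (L i)
  Im-row i = e (toℕ i) , λ j → sym (Σℤ-δ i (λ i′ → L i′ j))

  Im-Σ : ∀ {m} (c : Fin m → ℤ) (V : Fin m → Vecℤ n) → (∀ k → Im (V k)) →
         Im (λ j → Σℤ (λ k → c k * V k j))
  Im-Σ {zero}  c V Im-V = Im-𝟘
  Im-Σ {suc m} c V Im-V =
    Im-⊕ (Im-⊛ (c fzero) (Im-V fzero)) (Im-Σ (c ∘ fsuc) (V ∘ fsuc) (Im-V ∘ fsuc))

  ·-Im : ∀ u {x} (x∈Im : Im x) → u · x ≡ Σℤ (λ i → proj₁ x∈Im i * (u · L i))
  ·-Im u {x} (c , x≡cL) = begin
    Σℤ (λ j → u j * x j)
      ≡⟨ Σℤ-cong (λ j → cong (u j *_) (x≡cL j)) ⟩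
    Σℤ (λ j → u j * Σℤ (λ i → c i * L i j))
      ≡⟨ Σℤ-cong (λ j → sym (Σℤ-*ˡ (u j) (λ i → c i * L i j))) ⟩
    Σℤ (λ j → Σℤ (λ i → u j * (c i * L i j)))
      ≡⟨ Σℤ-comm (λ i j → u j * (c i * L i j)) ⟩
    Σℤ (λ i → Σℤ (λ j → u j * (c i * L i j)))
      ≡⟨ Σℤ-cong (λ i → trans (Σℤ-cong (λ j → xy-commute (u j) (c i) (L i j)))
                              (Σℤ-*ˡ (c i) (λ j → u j * L i j))) ⟩
    Σℤ (λ i → c i * (u · L i))
      ∎
    where
    open ≡-Reasoning
    xy-commute : ∀ a b c → a * (b * c) ≡ b * (a * c)
    xy-commute = solve-∀

  ·-Im-0 : ∀ u → (∀ i → u · L i ≡ 0ℤ) → ∀ {x} → Im x → u · x ≡ 0ℤ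
  ·-Im-0 u u·L≡0 x∈Im@(c , _) =
    trans (·-Im u x∈Im)
          (trans (Σℤ-cong (λ i → trans (cong (c i *_) (u·L≡0 i)) (ℤP.*-zeroʳ (c i)))) (Σℤ-0 {n}))

  ·-Im-∣ : ∀ u {d} → (∀ i → d Signed.∣ u · L i) → ∀ {x} → Im x → d Signed.∣ u · x
  ·-Im-∣ u d∣u·L x∈Im@(c , _) =
    Signed.∣-trans (Σℤ-∣ _ (λ i → Signed.∣n⇒∣m*n (c i) (d∣u·L i)))
                   (Signed.∣-reflexive (sym (·-Im u x∈Im)))

  -- A record around PicEq L, so that x and y can be inferred from x ≈ y.
  infix 4 _≈_
  record _≈_ (x y : Vecℤ n) : Set where
    constructor ≈-intro
    field ≈-Im : PicEq L x y
  open _≈_ public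

  ≗⇒≈ : ∀ {x y} → x ≗ y → x ≈ y
  ≗⇒≈ {x} {y} x≗y = ≈-intro (Im-resp (λ j → sym (x-y≡0 j)) Im-𝟘)
    where
    x-y≡0 : ∀ j → x j - y j ≡ 0ℤ
    x-y≡0 j = trans (cong (_-_ (x j)) (sym (x≗y j))) (ℤP.+-inverseʳ (x j))

  ≈-refl : ∀ {x} → x ≈ x
  ≈-refl = ≗⇒≈ (λ _ → refl)

  ≈-sym : ∀ {x y} → x ≈ y → y ≈ x
  ≈-sym {x} {y} (≈-intro x-y∈Im) =
    ≈-intro (Im-resp (λ j → negate (x j) (y j)) (Im-⊛ (- 1ℤ) x-y∈Im))
    where
    negate : ∀ a b → - 1ℤ * (a - b) ≡ b - a
    negate = solve-∀

  ≈-trans : ∀ {x y z} → x ≈ y → y ≈ z → x ≈ z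
  ≈-trans {x} {y} {z} (≈-intro x-y∈Im) (≈-intro y-z∈Im) =
    ≈-intro (Im-resp (λ j → telescope (x j) (y j) (z j)) (Im-⊕ x-y∈Im y-z∈Im))
    where
    telescope : ∀ a b c → (a - b) + (b - c) ≡ a - c
    telescope = solve-∀

  ⊕-cong : ∀ {x y z w} → x ≈ y → z ≈ w → x ⊕ z ≈ y ⊕ w
  ⊕-cong {x} {y} {z} {w} (≈-intro x-y∈Im) (≈-intro z-w∈Im) =
    ≈-intro (Im-resp (λ j → interchange (x j) (y j) (z j) (w j)) (Im-⊕ x-y∈Im z-w∈Im))
    where
    interchange : ∀ a b c d → (a - b) + (c - d) ≡ (a + c) - (b + d)
    interchange = solve-∀

  ⊖-cong : ∀ {x y z w} → x ≈ y → z ≈ w → x ⊖ z ≈ y ⊖ w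
  ⊖-cong {x} {y} {z} {w} (≈-intro x-y∈Im) (≈-intro z-w∈Im) =
    ≈-intro (Im-resp (λ j → interchange (x j) (y j) (z j) (w j)) (Im-⊕ x-y∈Im (Im-⊛ (- 1ℤ) z-w∈Im)))
    where
    interchange : ∀ a b c d → (a - b) + - 1ℤ * (c - d) ≡ (a - c) - (b - d)
    interchange = solve-∀

  Im⇒≈𝟘 : ∀ {x} → Im x → x ≈ 𝟘
  Im⇒≈𝟘 x∈Im = ≈-intro (Im-resp (λ j → sym (ℤP.+-identityʳ _)) x∈Im)

  ≈𝟘⇒Im : ∀ {x} → x ≈ 𝟘 → Im x
  ≈𝟘⇒Im (≈-intro x-𝟘∈Im) = Im-resp (λ j → ℤP.+-identityʳ _) x-𝟘∈Im

  ≈-via : ∀ {x y r} → x ⊖ y ≗ r → r ≈ 𝟘 → x ≈ y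
  ≈-via x⊖y≗r r≈𝟘 = ≈-intro (Im-resp (λ j → sym (x⊖y≗r j)) (≈𝟘⇒Im r≈𝟘))

  row≈𝟘 : ∀ i → L i ≈ 𝟘
  row≈𝟘 = Im⇒≈𝟘 ∘ Im-row

  ≈-setoid : Setoid _ _
  ≈-setoid = record
    { Carrier       = Vecℤ n
    ; _≈_           = _≈_
    ; isEquivalence = record { refl = ≈-refl ; sym = ≈-sym ; trans = ≈-trans }
    }

-- Pic ≅ ℤ × ℤₘ through x ↦ (u · x , v · x mod m), with inverse (a , c) ↦ a p + c q.
record ℤ×ℤ-Coordinates {n : ℕ} (L : Fin n → Fin n → ℤ) (m : ℕ) : Set where
  open Vectors n
  open Image L
  field
    u v p q   : Vecℤ n
    u·row≡0   : ∀ i → u · L i ≡ 0ℤ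
    m∣v·row   : ∀ i → + m Signed.∣ v · L i
    u·p≡1     : u · p ≡ 1ℤ
    v·p≡0     : v · p ≡ 0ℤ
    u·q≡0     : u · q ≡ 0ℤ
    v·q≡1     : v · q ≡ 1ℤ
    basis≈    : ∀ j → e (toℕ j) ≈ u j ⊛ p ⊕ v j ⊛ q
    m⊛q≈𝟘     : + m ⊛ q ≈ 𝟘

≡⇒ModEq : ∀ m {a b} → a ≡ b → ModEq m a b
≡⇒ModEq m {a} refl =
  Signed.∣⇒∣ᵤ {+ m} (divides 0ℤ (trans (ℤP.+-inverseʳ a) (sym (ℤP.*-zeroˡ (+ m)))))

module ℤ×ℤ-Coordinates-Properties {n} {L : Fin n → Fin n → ℤ} {m} (C : ℤ×ℤ-Coordinates L m) where

  open Vectors n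
  open Image L
  open ℤ×ℤ-Coordinates C

  -- x = Σⱼ xⱼ eⱼ, and basis≈ reduces every eⱼ.
  normal-form : ∀ x → x ≈ (u · x) ⊛ p ⊕ (v · x) ⊛ q
  normal-form x = ≈-intro (Im-resp expand (Im-Σ x reduction (≈-Im ∘ basis≈)))
    where
    reduction : Fin n → Vecℤ n
    reduction j = e (toℕ j) ⊖ (u j ⊛ p ⊕ v j ⊛ q)
    column : ∀ b → (λ j → reduction j b) ≗ e (toℕ b) ⊖ (p b ⊛ u ⊕ q b ⊛ v)
    column b j = cong₂ _-_ (δ-sym (toℕ b) (toℕ j))
                           (cong₂ _+_ (ℤP.*-comm (u j) (p b)) (ℤP.*-comm (v j) (q b)))
    commute : ∀ a b c d e → a - (b * c + d * e) ≡ a - (c * b + e * d)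
    commute = solve-∀
    expand : ∀ b → x · (λ j → reduction j b) ≡ x b - ((u · x) * p b + (v · x) * q b)
    expand b = begin
      x · (λ j → reduction j b)
        ≡⟨ ·-congʳ x (column b) ⟩
      x · (e (toℕ b) ⊖ (p b ⊛ u ⊕ q b ⊛ v))
        ≡⟨ ·-⊖ʳ x (e (toℕ b)) (p b ⊛ u ⊕ q b ⊛ v) ⟩
      x · e (toℕ b) - x · (p b ⊛ u ⊕ q b ⊛ v)
        ≡⟨ cong₂ _-_ (trans (·-comm x (e (toℕ b))) (Σℤ-δ b x)) (·-⊕ʳ x (p b ⊛ u) (q b ⊛ v)) ⟩
      x b - (x · (p b ⊛ u) + x · (q b ⊛ v))
        ≡⟨ cong₂ (λ s t → x b - (s + t)) (·-⊛ʳ x (p b) u) (·-⊛ʳ x (q b) v) ⟩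
      x b - (p b * (x · u) + q b * (x · v))
        ≡⟨ cong₂ (λ s t → x b - (p b * s + q b * t)) (·-comm x u) (·-comm x v) ⟩
      x b - (p b * (u · x) + q b * (v · x))
        ≡⟨ commute (x b) (p b) (u · x) (q b) (v · x) ⟩
      x b - ((u · x) * p b + (v · x) * q b)
        ∎
      where open ≡-Reasoning

  u·-resp : ∀ {x y} → x ≈ y → u · x ≡ u · y
  u·-resp {x} {y} x≈y =
    ℤP.i-j≡0⇒i≡j (u · x) (u · y) (trans (sym (·-⊖ʳ u x y)) (·-Im-0 u u·row≡0 (≈-Im x≈y)))

  v·-resp : ∀ {x y} → x ≈ y → ModEq m (v · x) (v · y)
  v·-resp {x} {y} x≈y =
    Signed.∣⇒∣ᵤ (subst (+ m Signed.∣_) (·-⊖ʳ v x y) (·-Im-∣ v m∣v·row (≈-Im x≈y)))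

  ⊛q-resp-ModEq : ∀ a b → ModEq m a b → a ⊛ q ≈ b ⊛ q
  ⊛q-resp-ModEq a b a≡b with Signed.∣ᵤ⇒∣ {+ m} {a - b} a≡b
  ... | divides k a-b≡km = ≈-intro (Im-resp rescale (Im-⊛ k (≈𝟘⇒Im m⊛q≈𝟘)))
    where
    regroup : ∀ k m x → k * (m * x) ≡ (k * m) * x
    regroup = solve-∀
    distrib : ∀ a b x → (a - b) * x ≡ a * x - b * x
    distrib = solve-∀
    rescale : ∀ j → k * (+ m * q j) ≡ a * q j - b * q j
    rescale j = trans (regroup k (+ m) (q j)) (trans (cong (_* q j) (sym a-b≡km)) (distrib a b (q j)))

  ≈-from-coordinates : ∀ {x y} → u · x ≡ u · y → ModEq m (v · x) (v · y) → x ≈ y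
  ≈-from-coordinates {x} {y} u·x≡u·y v·x≡v·y = begin
    x                          ≈⟨ normal-form x ⟩
    (u · x) ⊛ p ⊕ (v · x) ⊛ q  ≈⟨ ⊕-cong (≗⇒≈ (λ j → cong (_* p j) u·x≡u·y))
                                         (⊛q-resp-ModEq (v · x) (v · y) v·x≡v·y) ⟩
    (u · y) ⊛ p ⊕ (v · y) ⊛ q  ≈⟨ normal-form y ⟨
    y                          ∎
    where open SetoidReasoning ≈-setoid

  ·-section : ∀ w a c → w · (a ⊛ p ⊕ c ⊛ q) ≡ a * (w · p) + c * (w · q)
  ·-section w a c = trans (·-⊕ʳ w (a ⊛ p) (c ⊛ q)) (cong₂ _+_ (·-⊛ʳ w a p) (·-⊛ʳ w c q))

  pic-iso : PicIsoZ×Zm L m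
  pic-iso = (λ x → u · x , v · x)
          , (λ x y → ·-⊕ʳ u x y , ≡⇒ModEq m (·-⊕ʳ v x y))
          , (λ x y → (λ x≈y → u·-resp (≈-intro x≈y) , v·-resp (≈-intro x≈y))
                   , λ (u·x≡u·y , v·x≡v·y) → ≈-Im (≈-from-coordinates u·x≡u·y v·x≡v·y))
          , λ (a , c) → a ⊛ p ⊕ c ⊛ q
                      , trans (·-section u a c) (trans (cong₂ (combine a c) u·p≡1 u·q≡0) (first a c))
                      , ≡⇒ModEq m (trans (·-section v a c) (trans (cong₂ (combine a c) v·p≡0 v·q≡1) (second a c)))
    where
    combine : ℤ → ℤ → ℤ → ℤ → ℤ
    combine a c s t = a * s + c * t
    first : ∀ a c → a * 1ℤ + c * 0ℤ ≡ a
    first = solve-∀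
    second : ∀ a c → a * 0ℤ + c * 1ℤ ≡ c
    second = solve-∀

  torsion⇒u·≡0 : ∀ {x} → IsTorsion L x → u · x ≡ 0ℤ
  torsion⇒u·≡0 {x} (k , [1+k]x∈Im) = ℤP.*-cancelˡ-≡ (+ suc k) (u · x) 0ℤ (begin
    + suc k * (u · x)      ≡⟨ ·-⊛ʳ u (+ suc k) x ⟨
    u · (+ suc k ⊛ x)      ≡⟨ ·-Im-0 u u·row≡0 [1+k]x∈Im ⟩
    0ℤ                     ≡⟨ ℤP.*-zeroʳ (+ suc k) ⟨
    + suc k * 0ℤ           ∎)
    where open ≡-Reasoning

  jac-iso : .{{NonZero m}} → JacIsoZm L m
  jac-iso = (λ x _ → v · x)
          , (λ x y _ _ _ → ≡⇒ModEq m (·-⊕ʳ v x y))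
          , (λ x y x-tor y-tor → v·-resp ∘ ≈-intro
                               , ≈-Im ∘ ≈-from-coordinates (trans (torsion⇒u·≡0 x-tor)
                                                                  (sym (torsion⇒u·≡0 y-tor))))
          , λ b → b ⊛ q
                , (ℕ.pred m , Im-resp (multiple b) (Im-⊛ b (≈𝟘⇒Im m⊛q≈𝟘)))
                , ≡⇒ModEq m (trans (·-⊛ʳ v b q) (trans (cong (b *_) v·q≡1) (ℤP.*-identityʳ b)))
    where
    regroup : ∀ b m x → b * (m * x) ≡ m * (b * x)
    regroup = solve-∀
    multiple : ∀ b j → b * (+ m * q j) ≡ + suc (ℕ.pred m) * (b * q j)
    multiple b j = trans (regroup b (+ m) (q j)) (cong (λ k → + k * (b * q j)) (sym (ℕP.suc-pred m)))

module Cycle (m : ℕ) where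

  N M : ℕ
  N = suc (suc (suc m))
  M = suc (suc m)

  index≤m : ∀ {k} → suc (suc k) < N → k ≤ m
  index≤m = ℕP.≤-pred ∘ ℕP.≤-pred ∘ ℕP.≤-pred

  successor : ℕ → ℕ
  successor a = suc a % N

  successor-last : successor (suc (suc m)) ≡ 0
  successor-last = ℕD.n%n≡0 N

  successor-inner : ∀ {k} → k < m → successor (suc (suc k)) ≡ suc (suc (suc k))
  successor-inner k<m = ℕD.m<n⇒m%n≡m (s≤s (s≤s (s≤s k<m)))

  successor-≢ : ∀ {k} → k ≤ m → suc (suc k) ≢ successor (suc (suc k))
  successor-≢ {k} k≤m with k ℕP.≟ m
  ... | yes refl = λ eq → ℕP.1+n≢0 (trans eq successor-last)
  ... | no k≢m   = λ eq → ℕP.1+n≢n (sym (trans eq (successor-inner (ℕP.≤∧≢⇒< k≤m k≢m))))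

  out-neighbours : ℕ → List ℕ
  out-neighbours zero          = []
  out-neighbours (suc zero)    = 0 ∷ []
  out-neighbours (suc (suc k)) = suc k ∷ successor (suc (suc k)) ∷ []

  -- Vertex k+2 has one arrow back to k+1 (summands 3 and 5 of arrowsℕ) and one
  -- forward to its successor (summands 1 and 4).
  backward-arrow : ∀ k b → k ≤ m →
    [ suc (suc k) ℕP.≟ 2 ] ℕ.* [ b ℕP.≟ 1 ]
      ℕ.+ [ 2 ℕP.≤? b ] ℕ.* [ b ℕP.≤? N ∸ 2 ] ℕ.* [ suc (suc k) ℕP.≟ suc b ]
    ≡ [ b ℕP.≟ suc k ]
  backward-arrow zero    zero          _ = refl
  backward-arrow zero    (suc zero)    _ = refl
  backward-arrow zero    (suc (suc b)) _ =
    ℕP.*-zeroʳ ([ 2 ℕP.≤? suc (suc b) ] ℕ.* [ suc (suc b) ℕP.≤? suc m ])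
  backward-arrow (suc k) b k<m with b ℕP.≟ suc (suc k)
  ... | yes refl rewrite []-yes (suc (suc k) ℕP.≤? suc m) (s≤s k<m)
                       | []-yes (suc (suc (suc k)) ℕP.≟ suc (suc (suc k))) refl = refl
  ... | no b≢k+2 rewrite []-no (suc (suc (suc k)) ℕP.≟ suc b) (b≢k+2 ∘ sym ∘ ℕP.suc-injective) =
    ℕP.*-zeroʳ ([ 2 ℕP.≤? b ] ℕ.* [ b ℕP.≤? suc m ])

  forward-arrow : ∀ k b → k ≤ m →
    [ suc (suc k) ℕP.≟ N ∸ 1 ] ℕ.* [ b ℕP.≟ 0 ]
      ℕ.+ [ 2 ℕP.≤? suc (suc k) ] ℕ.* [ suc (suc k) ℕP.≤? N ∸ 2 ] ℕ.* [ b ℕP.≟ suc (suc (suc k)) ]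
    ≡ [ b ℕP.≟ successor (suc (suc k)) ]
  forward-arrow k b k≤m with k ℕP.≟ m
  ... | yes refl rewrite []-yes (suc (suc k) ℕP.≟ suc (suc k)) refl
                       | []-no (suc (suc k) ℕP.≤? suc k) ℕP.1+n≰n
                       | successor-last =
    trans (ℕP.+-identityʳ _) (ℕP.+-identityʳ _)
  ... | no k≢m rewrite []-no (suc (suc k) ℕP.≟ suc (suc m)) (k≢m ∘ ℕP.suc-injective ∘ ℕP.suc-injective)
                     | []-yes (suc (suc k) ℕP.≤? suc m) (s≤s (ℕP.≤∧≢⇒< k≤m k≢m))
                     | successor-inner (ℕP.≤∧≢⇒< k≤m k≢m) =
    ℕP.+-identityʳ _

  arrows≡occurrences : ∀ a b → a < N → arrowsℕ N a b ≡ occurrences b (out-neighbours a)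
  arrows≡occurrences zero          b       _   = ℕP.*-zeroʳ ([ 2 ℕP.≤? b ] ℕ.* [ b ℕP.≤? suc m ])
  arrows≡occurrences (suc zero)    zero    _   = refl
  arrows≡occurrences (suc zero)    (suc b) _   =
    ℕP.*-zeroʳ ([ 2 ℕP.≤? suc b ] ℕ.* [ suc b ℕP.≤? suc m ])
  arrows≡occurrences (suc (suc k)) b       a<N =
    trans (regroup to-v₁ to-v₂ to-next to-prev)
          (cong₂ ℕ._+_ (backward-arrow k b (index≤m a<N)) (cong (ℕ._+ 0) (forward-arrow k b (index≤m a<N))))
    where
    to-v₁ to-v₂ to-next to-prev : ℕ
    to-v₁   = [ suc (suc k) ℕP.≟ N ∸ 1 ] ℕ.* [ b ℕP.≟ 0 ]
    to-v₂   = [ suc (suc k) ℕP.≟ 2 ] ℕ.* [ b ℕP.≟ 1 ]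
    to-next = [ 2 ℕP.≤? suc (suc k) ] ℕ.* [ suc (suc k) ℕP.≤? N ∸ 2 ] ℕ.* [ b ℕP.≟ suc (suc (suc k)) ]
    to-prev = [ 2 ℕP.≤? b ] ℕ.* [ b ℕP.≤? N ∸ 2 ] ℕ.* [ suc (suc k) ℕP.≟ suc b ]
    regroup : ∀ p q r s → p ℕ.+ 0 ℕ.+ q ℕ.+ r ℕ.+ s ≡ (q ℕ.+ s) ℕ.+ ((p ℕ.+ r) ℕ.+ 0)
    regroup = ℕ-Solver.solve-∀

  out-neighbours-loopless : ∀ a → a < N → occurrences a (out-neighbours a) ≡ 0
  out-neighbours-loopless zero          _   = refl
  out-neighbours-loopless (suc zero)    _   = refl
  out-neighbours-loopless (suc (suc k)) a<N
    rewrite []-no (suc (suc k) ℕP.≟ suc k) ℕP.1+n≢n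
          | []-no (suc (suc k) ℕP.≟ successor (suc (suc k))) (successor-≢ (index≤m a<N)) = refl

  out-neighbours<N : ∀ a → a < N → All (_< N) (out-neighbours a)
  out-neighbours<N zero          _   = []
  out-neighbours<N (suc zero)    _   = s≤s z≤n ∷ []
  out-neighbours<N (suc (suc k)) a<N =
    ℕP.<-trans (ℕP.n<1+n (suc k)) a<N ∷ ℕD.m%n<n (suc (suc (suc k))) N ∷ []

  L : Fin N → Fin N → ℤ
  L = L-Cₙ N

  open Vectors N
  open Laplacian-Rows N
  open Image L

  L-row : ∀ i → L i ≗ laplacianRow (toℕ i) (out-neighbours (toℕ i))
  L-row i = Laplacian-row (Cₙ-arrows N) i (out-neighbours a)
              (λ j → arrows≡occurrences a (toℕ j) a<N) (out-neighbours-loopless a a<N) (out-neighbours<N a a<N)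
    where
    a : ℕ
    a = toℕ i
    a<N : a < N
    a<N = FinP.toℕ<n i

  weight : ℕ → ℤ
  weight zero    = 0ℤ
  weight (suc a) = + a

  𝟏·row≡0 : ∀ i → ⌊ const 1ℤ ⌋ · L i ≡ 0ℤ
  𝟏·row≡0 i = trans (·-congʳ ⌊ const 1ℤ ⌋ (L-row i))
                    (𝟏·laplacianRow (FinP.toℕ<n i) (out-neighbours<N (toℕ i) (FinP.toℕ<n i)))

  M∣weight·laplacianRow : ∀ a → a < N →
    + M Signed.∣ + length (out-neighbours a) * weight a - listSum weight (out-neighbours a)
  M∣weight·laplacianRow zero          _ = divides 0ℤ refl
  M∣weight·laplacianRow (suc zero)    _ = divides 0ℤ refl
  M∣weight·laplacianRow (suc (suc k)) a<N with k ℕP.≟ m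
  ... | yes refl rewrite successor-last = divides 1ℤ (last-row (+ k))
    where
    last-row : ∀ x → + 2 * (1ℤ + x) - (x + (0ℤ + 0ℤ)) ≡ 1ℤ * (1ℤ + (1ℤ + x))
    last-row = solve-∀
  ... | no k≢m rewrite successor-inner (ℕP.≤∧≢⇒< (index≤m a<N) k≢m) = divides 0ℤ (inner-row (+ k) (+ M))
    where
    inner-row : ∀ x y → + 2 * (1ℤ + x) - (x + ((1ℤ + (1ℤ + x)) + 0ℤ)) ≡ 0ℤ * y
    inner-row = solve-∀

  M∣weight·row : ∀ i → + M Signed.∣ ⌊ weight ⌋ · L i
  M∣weight·row i = subst (+ M Signed.∣_) (sym weight·row) (M∣weight·laplacianRow (toℕ i) (FinP.toℕ<n i))
    where
    weight·row : ⌊ weight ⌋ · L i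
               ≡ + length (out-neighbours (toℕ i)) * weight (toℕ i) - listSum weight (out-neighbours (toℕ i))
    weight·row = trans (·-congʳ ⌊ weight ⌋ (L-row i))
                       (·-laplacianRow weight (FinP.toℕ<n i) (out-neighbours<N (toℕ i) (FinP.toℕ<n i)))

  laplacianRow≈𝟘 : ∀ a → a < N → laplacianRow a (out-neighbours a) ≈ 𝟘
  laplacianRow≈𝟘 a a<N = ≈-trans (≗⇒≈ (λ j → sym (row-at-a j))) (row≈𝟘 i)
    where
    i : Fin N
    i = fromℕ< a<N
    row-at-a : L i ≗ laplacianRow a (out-neighbours a)
    row-at-a = subst (λ b → L i ≗ laplacianRow b (out-neighbours b)) (FinP.toℕ-fromℕ< a<N) (L-row i)

  g : Vecℤ N
  g = e 2 ⊖ e 1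

  t : ℕ → Vecℤ N
  t a = e (suc a) ⊖ e a

  e₁≈e₀ : e 1 ≈ e 0
  e₁≈e₀ = ≈-via (λ j → first-row (e 1 j) (e 0 j)) (laplacianRow≈𝟘 1 (s≤s (s≤s z≤n)))
    where
    first-row : ∀ x y → x - y ≡ + 1 * x - (y + 0ℤ)
    first-row = solve-∀

  t-step : ∀ k → k < m → t (suc (suc k)) ≈ t (suc k)
  t-step k k<m = ≈-sym (≈-via (λ j → inner-row (e (suc k) j) (e (suc (suc k)) j) (e (suc (suc (suc k))) j))
                              inner-row≈𝟘)
    where
    inner-row : ∀ x y z → (y - x) - (z - y) ≡ + 2 * y - (x + (z + 0ℤ))
    inner-row = solve-∀
    inner-row≈𝟘 : laplacianRow (suc (suc k)) (suc k ∷ suc (suc (suc k)) ∷ []) ≈ 𝟘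
    inner-row≈𝟘 = subst (λ c → laplacianRow (suc (suc k)) (suc k ∷ c ∷ []) ≈ 𝟘) (successor-inner k<m)
                        (laplacianRow≈𝟘 (suc (suc k)) (s≤s (s≤s (s≤s (ℕP.<⇒≤ k<m)))))

  t≈g : ∀ k → k ≤ m → t (suc k) ≈ g
  t≈g zero    _     = ≈-refl
  t≈g (suc k) k+1≤m = ≈-trans (t-step k k+1≤m) (t≈g k (ℕP.<⇒≤ k+1≤m))

  e-suc≈ : ∀ k → k ≤ suc m → e (suc k) ≈ e 0 ⊕ + k ⊛ g
  e-suc≈ zero _ = ≈-trans e₁≈e₀ (≗⇒≈ (λ j → sym (add-zero (e 0 j) (g j))))
    where
    add-zero : ∀ x y → x + 0ℤ * y ≡ x
    add-zero = solve-∀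
  e-suc≈ (suc k) k+1≤m+1 = begin
    e (suc (suc k))        ≈⟨ ≗⇒≈ (λ j → telescope (e (suc k) j) (e (suc (suc k)) j)) ⟩
    e (suc k) ⊕ t (suc k)  ≈⟨ ⊕-cong (e-suc≈ k (ℕP.<⇒≤ k+1≤m+1)) (t≈g k (ℕP.≤-pred k+1≤m+1)) ⟩
    (e 0 ⊕ + k ⊛ g) ⊕ g    ≈⟨ ≗⇒≈ (λ j → collect (e 0 j) (+ k) (g j)) ⟩
    e 0 ⊕ + suc k ⊛ g      ∎
    where
    open SetoidReasoning ≈-setoid
    telescope : ∀ x y → y ≡ x + (y - x)
    telescope = solve-∀
    collect : ∀ x k y → (x + k * y) + y ≡ x + (1ℤ + k) * y
    collect = solve-∀

  M⊛g≈𝟘 : + M ⊛ g ≈ 𝟘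
  M⊛g≈𝟘 = begin
    + M ⊛ g
      ≈⟨ ≗⇒≈ (λ j → expand (e 0 j) (+ m) (g j)) ⟩
    g ⊕ ((e 0 ⊕ + suc m ⊛ g) ⊖ e 0)
      ≈⟨ ⊕-cong (≈-sym (t≈g m ℕP.≤-refl)) (⊖-cong (≈-sym (e-suc≈ (suc m) ℕP.≤-refl)) ≈-refl) ⟩
    t (suc m) ⊕ (e (suc (suc m)) ⊖ e 0)
      ≈⟨ ≗⇒≈ (λ j → last-row (e 0 j) (e (suc m) j) (e (suc (suc m)) j)) ⟩
    laplacianRow (suc (suc m)) (suc m ∷ 0 ∷ [])
      ≈⟨ subst (λ c → laplacianRow (suc (suc m)) (suc m ∷ c ∷ []) ≈ 𝟘) successor-last
               (laplacianRow≈𝟘 (suc (suc m)) ℕP.≤-refl) ⟩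
    𝟘
      ∎
    where
    open SetoidReasoning ≈-setoid
    expand : ∀ x k y → (1ℤ + (1ℤ + k)) * y ≡ y + ((x + (1ℤ + k) * y) - x)
    expand = solve-∀
    last-row : ∀ x y z → (z - y) + (z - x) ≡ + 2 * z - (y + (x + 0ℤ))
    last-row = solve-∀

  e≈e₀⊕weight⊛g : ∀ a → a < N → e a ≈ 1ℤ ⊛ e 0 ⊕ weight a ⊛ g
  e≈e₀⊕weight⊛g zero    _   = ≗⇒≈ (λ j → origin (e 0 j) (g j))
    where
    origin : ∀ x y → x ≡ 1ℤ * x + 0ℤ * y
    origin = solve-∀
  e≈e₀⊕weight⊛g (suc k) a<N =
    ≈-trans (e-suc≈ k (ℕP.≤-pred (ℕP.≤-pred a<N)))
            (≗⇒≈ (λ j → cong (_+ (+ k * g j)) (sym (ℤP.*-identityˡ (e 0 j)))))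

  coordinates : ℤ×ℤ-Coordinates L M
  coordinates = record
    { u       = ⌊ const 1ℤ ⌋
    ; v       = ⌊ weight ⌋
    ; p       = e 0
    ; q       = g
    ; u·row≡0 = 𝟏·row≡0
    ; m∣v·row = M∣weight·row
    ; u·p≡1   = ·-e (const 1ℤ) 0<N
    ; v·p≡0   = ·-e weight 0<N
    ; u·q≡0   = trans (·-⊖ʳ ⌊ const 1ℤ ⌋ (e 2) (e 1)) (cong₂ _-_ (·-e (const 1ℤ) 2<N) (·-e (const 1ℤ) 1<N))
    ; v·q≡1   = trans (·-⊖ʳ ⌊ weight ⌋ (e 2) (e 1)) (cong₂ _-_ (·-e weight 2<N) (·-e weight 1<N))
    ; basis≈  = λ j → e≈e₀⊕weight⊛g (toℕ j) (FinP.toℕ<n j)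
    ; m⊛q≈𝟘   = M⊛g≈𝟘
    }
    where
    0<N : 0 < N
    0<N = s≤s z≤n
    1<N : 1 < N
    1<N = s≤s (s≤s z≤n)
    2<N : 2 < N
    2<N = s≤s (s≤s (s≤s z≤n))

lemma4p5 : (n : ℕ) → 3 ≤ n →
    PicIsoZ×Zm (L-Cₙ n) (n ∸ 1) × JacIsoZm (L-Cₙ n) (n ∸ 1)
lemma4p5 (suc (suc (suc m))) (s≤s (s≤s (s≤s _))) = pic-iso , jac-iso
  where open ℤ×ℤ-Coordinates-Properties (Cycle.coordinates m)
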